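{- For every $n\ge 1$, there is an exact affine OBDD on the $2n$ variables $x_1,\dots,x_n,y_1,\dots,y_n$ with the identity order (reading $x_1,\dots,x_n,y_1,\dots,y_n$), having $p(n)^2$ classical states and $n+1$ affine states, that computes the mixed weighted sum function $\mathtt{MWS}_n$.
   Context: $p(n)$ is the smallest prime greater than $n$; for $z\in\{0,1\}^n$, $s_n(z)=\left(\sum_{i=1}^n i\cdot z_i\right)\bmod p(n)$. $\mathtt{MWS}_n:\{0,1\}^n\times\{0,1\}^n\to\{0,1\}$ is defined by $\mathtt{MWS}_n(x,y)=x_i\oplus y_i$ if $i=s_n(x)=s_n(y)\in\{1,\dots,n\}$, and $0$ otherwise. An affine OBDD (AfOBDD) is a tuple $(S,E,\delta,T,s_I,v_0,S_a,E_a,\pi)$: $S$ is a finite set of classical states with initial state $s_I$ and accepting set $S_a$; $E=\{e_1,\dots,e_{m_2}\}$ is a set of affine states with accepting set $E_a$; $v_0\in\mathbb{R}^{m_2}$ is an initial affine state (entries sum to $1$); $\pi$ is a permutation of the variable indices; for each step $i$, $\delta_i:S\times\{0,1\}\to S$; and for each step $i$, classical state $s$ and bit $b$, $T_i^{s,b}$ is a real $m_2\times m_2$ matrix each of whose columns sums to $1$. On an input it starts in $(s_I,v_0)$; at step $j$, from $(s,v_{j-1})$ it sets $v_j=T_j^{s,b}v_{j-1}$ where $b$ is the bit read at step $j$, and then sets the classical state to $\delta_j(s,b)$. If the final classical state is not in $S_a$ it rejects; otherwise it accepts with probability $\sum_{e_i\in E_a}|v_f[i]|/\|v_f\|_1$.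 It computes $f$ exactly if $1$-inputs are accepted with probability $1$ and $0$-inputs with probability $0$. -}

module Defs where

open import Data.Nat as ℕ using (ℕ; zero; suc; _<_; _<?_; _%_)
open import Data.Nat.Primality using (Prime)
open import Data.Fin using (Fin; zero; suc; toℕ; fromℕ<; _↑ˡ_; _↑ʳ_)
open import Data.Bool using (Bool; true; false; if_then_else_; _xor_)
open import Data.Rational as ℚ using (ℚ; 0ℚ; 1ℚ; _+_; _*_; ∣_∣; _÷_)
open import Data.Rational.Properties as ℚP using ()
open import Data.List using (List; foldl; allFin)
open import Data.Product using (_×_; _,_; proj₁; proj₂)
open import Data.Fin.Permutation using (Permutation′; _⟨$⟩ʳ_)
open import Relation.Nullary using (¬_; yes; no)
open import Relation.Binary.PropositionalEquality using (_≡_)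

Σℕ : (m : ℕ) → (Fin m → ℕ) → ℕ
Σℕ zero    f = 0
Σℕ (suc m) f = f zero ℕ.+ Σℕ m (λ i → f (suc i))

Σℚ : (m : ℕ) → (Fin m → ℚ) → ℚ
Σℚ zero    f = 0ℚ
Σℚ (suc m) f = f zero + Σℚ m (λ i → f (suc i))

IsSmallestPrimeAbove : ℕ → ℕ → Set
IsSmallestPrimeAbove n p =
  Prime p × n < p × (∀ q → n < q → q < p → ¬ Prime q)

-- m mod p (p is always a prime here, hence nonzero; the zero case is dummy)
modP : ℕ → ℕ → ℕ
modP m zero    = m
modP m (suc q) = m % suc q

bit : Bool → ℕ
bit true  = 1
bit false = 0

-- s_n(z) = (Σ_{i=1}^n i·z_i) mod p ; z_i is z (i-1) (0-based Fin index)
weightSum : (n p : ℕ) → (Fin n → Bool) → ℕ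
weightSum n p z = modP (Σℕ n (λ i → suc (toℕ i) ℕ.* bit (z i))) p

MWS : (n p : ℕ) → (Fin n → Bool) → (Fin n → Bool) → Bool
MWS n p x y with weightSum n p x ℕ.≟ weightSum n p y
... | no  _ = false
... | yes _ with weightSum n p x
...   | zero = false
...   | suc k with k <? n
...     | yes k<n = x (fromℕ< k<n) xor y (fromℕ< k<n)
...     | no  _   = false

xPart : (n : ℕ) → (Fin (n ℕ.+ n) → Bool) → Fin n → Bool
xPart n w i = w (i ↑ˡ n)

yPart : (n : ℕ) → (Fin (n ℕ.+ n) → Bool) → Fin n → Bool
yPart n w i = w (n ↑ʳ i)

-- Affine OBDDs over N variables, with k classical states (Fin k)
-- and m affine states (Fin m); real entries are taken rational.

Matrix : ℕ → Set
Matrix m = Fin m → Fin m → ℚ   -- M r c : row r, column c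

_·_ : ∀ {m} → Matrix m → (Fin m → ℚ) → (Fin m → ℚ)
_·_ {m} M v r = Σℚ m (λ c → M r c * v c)

record AfOBDD (N k m : ℕ) : Set where
  field
    sI    : Fin k
    Sa    : Fin k → Bool          -- accepting classical states
    Ea    : Fin m → Bool          -- accepting affine states
    v₀    : Fin m → ℚ
    v₀-sum : Σℚ m v₀ ≡ 1ℚ
    π     : Permutation′ N        -- variable read at step j is π j
    δ     : Fin N → Fin k → Bool → Fin k
    T     : Fin N → Fin k → Bool → Matrix m
    T-col : ∀ j s b c → Σℚ m (λ r → T j s b r c) ≡ 1ℚ

module _ {N k m : ℕ} (A : AfOBDD N k m) where
  open AfOBDD A

  step : (Fin N → Bool) → (Fin k × (Fin m → ℚ)) → Fin N → (Fin k × (Fin m → ℚ))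
  step w (s , v) j = let b = w (π ⟨$⟩ʳ j) in δ j s b , (T j s b · v)

  run : (Fin N → Bool) → Fin k × (Fin m → ℚ)
  run w = foldl (step w) (sI , v₀) (allFin N)

  norm₁ : (Fin m → ℚ) → ℚ
  norm₁ v = Σℚ m (λ i → ∣ v i ∣)

  accMass : (Fin m → ℚ) → ℚ
  accMass v = Σℚ m (λ i → if Ea i then ∣ v i ∣ else 0ℚ)

  -- acceptance probability (the ‖v‖₁ = 0 case cannot occur since
  -- entries always sum to 1; it is given the dummy value 0)
  affineProb : (Fin m → ℚ) → ℚ
  affineProb v with norm₁ v ℚP.≟ 0ℚ
  ... | yes _  = 0ℚ
  ... | no  ≢0 = _÷_ (accMass v) (norm₁ v) {{ℚ.≢-nonZero ≢0}}

  acceptProb : (Fin N → Bool) → ℚ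
  acceptProb w with run w
  ... | (s , v) = if Sa s then affineProb v else 0ℚ

  IdentityOrder : Set
  IdentityOrder = ∀ j → π ⟨$⟩ʳ j ≡ j

  ComputesExactly : ((Fin N → Bool) → Bool) → Set
  ComputesExactly f = ∀ w →
    (f w ≡ true → acceptProb w ≡ 1ℚ) × (f w ≡ false → acceptProb w ≡ 0ℚ)

-- A classical state holds the pair (Σ i·xᵢ mod p, Σ i·yᵢ mod p) of running weighted sums, so
-- at the end the classical part accepts exactly when s(x) = s(y) = k ∈ {1..n}.  The affine
-- part first loads x into the coordinates 1..n of the affine vector (reading xᵢ = 1 adds
-- eᵢ − e₀, keeping the entries' sum equal to 1).  When yₖ is read and the first register
-- holds k, the affine vector v is replaced by the basis vector e₀ if xₖ ⊕ yₖ = 1 and eₖ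
-- otherwise; since vₖ = xₖ and the entries of v sum to 1, this is an affine map of v.
-- The final affine vector is then a basis vector, so acceptance is exact.
module Submission where

open import Defs
open import Data.Empty using (⊥-elim)
open import Data.Bool using (Bool; true; false; if_then_else_; _xor_; _∧_)
open import Data.Fin using (Fin; zero; suc; toℕ; fromℕ<; _↑ˡ_; _↑ʳ_; splitAt; combine; remQuot)
open import Data.Fin.Permutation as Permutation using ()
open import Data.Fin.Properties as Fin
  using (toℕ-injective; suc-injective; toℕ<n; toℕ-fromℕ<; splitAt-↑ˡ; splitAt-↑ʳ; remQuot-combine)
open import Data.List using (_∷_; _++_; foldl; tabulate)
open import Data.List.Properties using (foldl-++)
open import Data.Maybe using (Maybe; just; nothing; is-just; maybe′)
open import Data.Nat as ℕ using (ℕ; zero; suc; _≤_; _<_; _%_; _<?_; s≤s⁻¹)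
open import Data.Nat.DivMod using (_mod_; %-distribˡ-+; m%n%n≡m%n)
open import Data.Nat.Properties
  using (+-comm; +-assoc; *-zeroʳ; ≤-refl; <⇒≤; <-irrefl; <-≤-trans; ≤∧≢⇒<; m<n⇒m<1+n; n<1+n)
open import Data.Product using (Σ-syntax; _×_; _,_; proj₁; proj₂)
open import Data.Rational using (ℚ; 0ℚ; 1ℚ; _+_; _*_; _-_; -_; _÷_; ∣_∣; NonZero; ≢-nonZero)
import Data.Rational.Properties as ℚ
open import Data.Rational.Solver using (module +-*-Solver)
open import Data.Sum using (_⊎_; inj₁; inj₂)
open import Function using (_∘_)
open import Relation.Nullary using (Dec; yes; no; does)
open import Relation.Nullary.Decidable using (dec-true; dec-false)
open import Relation.Binary.PropositionalEquality

open +-*-Solver using (solve; _:+_; _:-_; _:*_; _:=_; con)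
open ≡-Reasoning

tabulate-+ : ∀ {A : Set} m {k} (g : Fin (m ℕ.+ k) → A) →
             tabulate g ≡ tabulate (g ∘ (_↑ˡ k)) ++ tabulate (g ∘ (m ↑ʳ_))
tabulate-+ zero    g = refl
tabulate-+ (suc m) g = cong (g zero ∷_) (tabulate-+ m (g ∘ suc))

foldl-tabulate-invariant : ∀ {A S : Set} {m} (P : ℕ → S → Set) {f : S → A → S} {g : Fin m → A} →
                           (∀ i {s} → P (toℕ i) s → P (suc (toℕ i)) (f s (g i))) →
                           ∀ {s} → P 0 s → P m (foldl f s (tabulate g))
foldl-tabulate-invariant {m = zero}  P step P₀ = P₀
foldl-tabulate-invariant {m = suc m} P step P₀ =
  foldl-tabulate-invariant (P ∘ suc) (step ∘ suc) (step zero P₀)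

Σℕ-cong : ∀ {m} {f g : Fin m → ℕ} → f ≗ g → Σℕ m f ≡ Σℕ m g
Σℕ-cong {zero}  f≗g = refl
Σℕ-cong {suc m} f≗g = cong₂ ℕ._+_ (f≗g zero) (Σℕ-cong (f≗g ∘ suc))

Σℕ-zero : ∀ m → Σℕ m (λ _ → 0) ≡ 0
Σℕ-zero zero    = refl
Σℕ-zero (suc m) = Σℕ-zero m

Σℕ-insert : ∀ {m} (f g : Fin m → ℕ) j → (∀ i → j ≢ i → g i ≡ f i) → f j ≡ 0 →
            Σℕ m g ≡ Σℕ m f ℕ.+ g j
Σℕ-insert {suc m} f g zero g≡f fj≡0 = begin
  g zero ℕ.+ Σℕ m (g ∘ suc)             ≡⟨ cong (g zero ℕ.+_) (Σℕ-cong λ i → g≡f (suc i) λ ()) ⟩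
  g zero ℕ.+ Σℕ m (f ∘ suc)             ≡⟨ +-comm (g zero) _ ⟩
  Σℕ m (f ∘ suc) ℕ.+ g zero             ≡⟨ cong (λ a → a ℕ.+ Σℕ m (f ∘ suc) ℕ.+ g zero) fj≡0 ⟨
  f zero ℕ.+ Σℕ m (f ∘ suc) ℕ.+ g zero  ∎
Σℕ-insert {suc m} f g (suc j) g≡f fj≡0 = begin
  g zero ℕ.+ Σℕ m (g ∘ suc)                    ≡⟨ cong₂ ℕ._+_ (g≡f zero λ ()) (Σℕ-insert (f ∘ suc) (g ∘ suc) j
                                                    (λ i j≢i → g≡f (suc i) (j≢i ∘ suc-injective)) fj≡0) ⟩
  f zero ℕ.+ (Σℕ m (f ∘ suc) ℕ.+ g (suc j))  ≡⟨ +-assoc (f zero) _ _ ⟨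
  f zero ℕ.+ Σℕ m (f ∘ suc) ℕ.+ g (suc j)    ∎

[m%n+o]%n≡[m+o]%n : ∀ m o n .{{_ : ℕ.NonZero n}} → (m % n ℕ.+ o) % n ≡ (m ℕ.+ o) % n
[m%n+o]%n≡[m+o]%n m o n = begin
  (m % n ℕ.+ o) % n          ≡⟨ %-distribˡ-+ (m % n) o n ⟩
  (m % n % n ℕ.+ o % n) % n  ≡⟨ cong (λ a → (a ℕ.+ o % n) % n) (m%n%n≡m%n m n) ⟩
  (m % n ℕ.+ o % n) % n      ≡⟨ %-distribˡ-+ m o n ⟨
  (m ℕ.+ o) % n              ∎

Σℚ-cong : ∀ {m} {f g : Fin m → ℚ} → f ≗ g → Σℚ m f ≡ Σℚ m g
Σℚ-cong {zero}  f≗g = refl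
Σℚ-cong {suc m} f≗g = cong₂ _+_ (f≗g zero) (Σℚ-cong (f≗g ∘ suc))

Σℚ-zero : ∀ m → Σℚ m (λ _ → 0ℚ) ≡ 0ℚ
Σℚ-zero zero    = refl
Σℚ-zero (suc m) = trans (ℚ.+-identityˡ _) (Σℚ-zero m)

Σℚ-+ : ∀ {m} (f g : Fin m → ℚ) → Σℚ m (λ i → f i + g i) ≡ Σℚ m f + Σℚ m g
Σℚ-+ {zero}  f g = refl
Σℚ-+ {suc m} f g = trans (cong (f zero + g zero +_) (Σℚ-+ (f ∘ suc) (g ∘ suc)))
                         (solve 4 (λ a b c d → (a :+ b) :+ (c :+ d) := (a :+ c) :+ (b :+ d)) refl
                                (f zero) (g zero) (Σℚ m (f ∘ suc)) (Σℚ m (g ∘ suc)))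

Σℚ-neg : ∀ {m} (f : Fin m → ℚ) → Σℚ m (λ i → - f i) ≡ - Σℚ m f
Σℚ-neg {zero}  f = refl
Σℚ-neg {suc m} f = trans (cong (- f zero +_) (Σℚ-neg (f ∘ suc))) (sym (ℚ.neg-distrib-+ (f zero) _))

Σℚ-*ˡ : ∀ {m} a (f : Fin m → ℚ) → Σℚ m (λ i → a * f i) ≡ a * Σℚ m f
Σℚ-*ˡ {zero}  a f = sym (ℚ.*-zeroʳ a)
Σℚ-*ˡ {suc m} a f = trans (cong (a * f zero +_) (Σℚ-*ˡ a (f ∘ suc))) (sym (ℚ.*-distribˡ-+ a _ _))

Σℚ-*ʳ : ∀ {m} a (f : Fin m → ℚ) → Σℚ m (λ i → f i * a) ≡ Σℚ m f * a
Σℚ-*ʳ a f = trans (Σℚ-cong λ i → ℚ.*-comm (f i) a) (trans (Σℚ-*ˡ a f) (ℚ.*-comm a _))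

Σℚ-swap : ∀ {m k} (f : Fin m → Fin k → ℚ) →
          Σℚ m (λ r → Σℚ k (f r)) ≡ Σℚ k (λ c → Σℚ m (λ r → f r c))
Σℚ-swap {zero}  {k} f = sym (Σℚ-zero k)
Σℚ-swap {suc m}     f = trans (cong (Σℚ _ (f zero) +_) (Σℚ-swap (f ∘ suc))) (sym (Σℚ-+ (f zero) _))

_-ᵛ_ : ∀ {m} → (Fin m → ℚ) → (Fin m → ℚ) → Fin m → ℚ
(u -ᵛ w) r = u r - w r

Σℚ-- : ∀ {m} (u w : Fin m → ℚ) → Σℚ m (u -ᵛ w) ≡ Σℚ m u - Σℚ m w
Σℚ-- u w = trans (Σℚ-+ u (λ i → - w i)) (cong (Σℚ _ u +_) (Σℚ-neg w))

basis : ∀ {m} → Fin m → Fin m → ℚ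
basis zero    zero    = 1ℚ
basis zero    (suc _) = 0ℚ
basis (suc _) zero    = 0ℚ
basis (suc k) (suc r) = basis k r

basis-sym : ∀ {m} (k r : Fin m) → basis k r ≡ basis r k
basis-sym zero    zero    = refl
basis-sym zero    (suc _) = refl
basis-sym (suc _) zero    = refl
basis-sym (suc k) (suc r) = basis-sym k r

basis-diag : ∀ {m} (k : Fin m) → basis k k ≡ 1ℚ
basis-diag zero    = refl
basis-diag (suc k) = basis-diag k

basis-off : ∀ {m} {k r : Fin m} → k ≢ r → basis k r ≡ 0ℚ
basis-off {k = zero}  {zero}  k≢r = ⊥-elim (k≢r refl)
basis-off {k = zero}  {suc _} k≢r = refl
basis-off {k = suc _} {zero}  k≢r = refl
basis-off {k = suc k} {suc r} k≢r = basis-off (k≢r ∘ cong suc)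

∣basis∣ : ∀ {m} (k r : Fin m) → ∣ basis k r ∣ ≡ basis k r
∣basis∣ zero    zero    = refl
∣basis∣ zero    (suc _) = refl
∣basis∣ (suc _) zero    = refl
∣basis∣ (suc k) (suc r) = ∣basis∣ k r

Σℚ-basis : ∀ {m} (k : Fin m) → Σℚ m (basis k) ≡ 1ℚ
Σℚ-basis {suc m} zero    = trans (cong (1ℚ +_) (Σℚ-zero m)) (ℚ.+-identityʳ 1ℚ)
Σℚ-basis {suc m} (suc k) = trans (ℚ.+-identityˡ _) (Σℚ-basis k)

Σℚ-basis-* : ∀ {m} (k : Fin m) (f : Fin m → ℚ) → Σℚ m (λ c → basis k c * f c) ≡ f k
Σℚ-basis-* {suc m} zero f = begin
  1ℚ * f zero + Σℚ m (λ c → 0ℚ * f (suc c))  ≡⟨ cong₂ _+_ (ℚ.*-identityˡ (f zero))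
                                                   (trans (Σℚ-cong (ℚ.*-zeroˡ ∘ f ∘ suc)) (Σℚ-zero m)) ⟩
  f zero + 0ℚ                                 ≡⟨ ℚ.+-identityʳ _ ⟩
  f zero                                      ∎
Σℚ-basis-* {suc m} (suc k) f =
  trans (cong₂ _+_ (ℚ.*-zeroˡ (f zero)) (Σℚ-basis-* k (f ∘ suc))) (ℚ.+-identityˡ _)

Σℚ-basis-difference : ∀ {m} (k l : Fin m) → Σℚ m (basis k -ᵛ basis l) ≡ 0ℚ
Σℚ-basis-difference k l = trans (Σℚ-- (basis k) (basis l)) (cong₂ _-_ (Σℚ-basis k) (Σℚ-basis l))

1ᴹ : ∀ {m} → Matrix m
1ᴹ = basis

infixl 6 _+ᴹ_
infixl 7 _⊗_

_+ᴹ_ : ∀ {m} → Matrix m → Matrix m → Matrix m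
(M +ᴹ N) r c = M r c + N r c

_⊗_ : ∀ {m} → (Fin m → ℚ) → (Fin m → ℚ) → Matrix m
(u ⊗ w) r c = u r * w c

𝟙 : ∀ {m} → Fin m → ℚ
𝟙 _ = 1ℚ

colSum : ∀ {m} → Matrix m → Fin m → ℚ
colSum {m} M c = Σℚ m (λ r → M r c)

·-1ᴹ : ∀ {m} (v : Fin m → ℚ) → (1ᴹ · v) ≗ v
·-1ᴹ v r = Σℚ-basis-* r v

·-+ᴹ : ∀ {m} (M N : Matrix m) v r → ((M +ᴹ N) · v) r ≡ (M · v) r + (N · v) r
·-+ᴹ M N v r = trans (Σℚ-cong λ c → ℚ.*-distribʳ-+ (v c) (M r c) (N r c))
                     (Σℚ-+ (λ c → M r c * v c) (λ c → N r c * v c))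

·-⊗ : ∀ {m} (u w v : Fin m → ℚ) r → ((u ⊗ w) · v) r ≡ u r * Σℚ m (λ c → w c * v c)
·-⊗ u w v r = trans (Σℚ-cong λ c → ℚ.*-assoc (u r) (w c) (v c)) (Σℚ-*ˡ (u r) (λ c → w c * v c))

·-⊗𝟙 : ∀ {m} (u v : Fin m → ℚ) r → ((u ⊗ 𝟙) · v) r ≡ u r * Σℚ m v
·-⊗𝟙 u v r = trans (·-⊗ u 𝟙 v r) (cong (u r *_) (Σℚ-cong (ℚ.*-identityˡ ∘ v)))

·-⊗basis : ∀ {m} (u : Fin m → ℚ) k v r → ((u ⊗ basis k) · v) r ≡ u r * v k
·-⊗basis u k v r = trans (·-⊗ u (basis k) v r) (cong (u r *_) (Σℚ-basis-* k v))

colSum-1ᴹ : ∀ {m} (c : Fin m) → colSum 1ᴹ c ≡ 1ℚ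
colSum-1ᴹ c = trans (Σℚ-cong λ r → basis-sym r c) (Σℚ-basis c)

colSum-+ᴹ : ∀ {m} (M N : Matrix m) c → colSum (M +ᴹ N) c ≡ colSum M c + colSum N c
colSum-+ᴹ M N c = Σℚ-+ (λ r → M r c) (λ r → N r c)

colSum-⊗ : ∀ {m} (u w : Fin m → ℚ) c → colSum (u ⊗ w) c ≡ Σℚ m u * w c
colSum-⊗ u w c = Σℚ-*ʳ (w c) u

colSum-difference⊗ : ∀ {m} (k l : Fin m) w c → colSum ((basis k -ᵛ basis l) ⊗ w) c ≡ 0ℚ
colSum-difference⊗ k l w c =
  trans (colSum-⊗ _ w c) (trans (cong (_* w c) (Σℚ-basis-difference k l)) (ℚ.*-zeroˡ (w c)))

colSum-basis⊗𝟙 : ∀ {m} (k c : Fin m) → colSum (basis k ⊗ 𝟙) c ≡ 1ℚ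
colSum-basis⊗𝟙 k c = trans (colSum-⊗ (basis k) 𝟙 c) (cong (_* 1ℚ) (Σℚ-basis k))

Σℚ-· : ∀ {m} (M : Matrix m) v → (∀ c → colSum M c ≡ 1ℚ) → Σℚ m (M · v) ≡ Σℚ m v
Σℚ-· {m} M v colSum≡1 = begin
  Σℚ m (λ r → Σℚ m (λ c → M r c * v c))  ≡⟨ Σℚ-swap (λ r c → M r c * v c) ⟩
  Σℚ m (λ c → Σℚ m (λ r → M r c * v c))  ≡⟨ Σℚ-cong (λ c → Σℚ-*ʳ (v c) (λ r → M r c)) ⟩
  Σℚ m (λ c → colSum M c * v c)          ≡⟨ Σℚ-cong (λ c → trans (cong (_* v c) (colSum≡1 c)) (ℚ.*-identityˡ _)) ⟩
  Σℚ m v                                 ∎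

bitℚ : Bool → ℚ
bitℚ b = if b then 1ℚ else 0ℚ

interpolate : ∀ c a b → (a - b) * bitℚ c + b * 1ℚ ≡ (if c then a else b)
interpolate true  = solve 2 (λ a b → (a :- b) :* con 1ℚ :+ b :* con 1ℚ := a) refl
interpolate false = solve 2 (λ a b → (a :- b) :* con 0ℚ :+ b :* con 1ℚ := b) refl

if-then-0 : ∀ b a → (if b then a else 0ℚ) ≡ a * bitℚ b
if-then-0 true  a = sym (ℚ.*-identityʳ a)
if-then-0 false a = sym (ℚ.*-zeroʳ a)

1ℚ≢0ℚ : 1ℚ ≢ 0ℚ
1ℚ≢0ℚ ()

÷-identityʳ : ∀ a b .{{_ : NonZero b}} → b ≡ 1ℚ → a ÷ b ≡ a
÷-identityʳ a .1ℚ refl = ℚ.*-identityʳ a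

module _ {N k m} (A : AfOBDD N k m) where
  open AfOBDD A

  norm₁-basis : ∀ {v} c → v ≗ basis c → norm₁ A v ≡ 1ℚ
  norm₁-basis c v≗e = trans (Σℚ-cong λ r → trans (cong ∣_∣ (v≗e r)) (∣basis∣ c r)) (Σℚ-basis c)

  accMass-basis : ∀ {v} c → v ≗ basis c → accMass A v ≡ bitℚ (Ea c)
  accMass-basis {v} c v≗e = trans (Σℚ-cong mass) (Σℚ-basis-* c (bitℚ ∘ Ea))
    where
    mass : ∀ i → (if Ea i then ∣ v i ∣ else 0ℚ) ≡ basis c i * bitℚ (Ea i)
    mass i = trans (if-then-0 (Ea i) _) (cong (_* bitℚ (Ea i)) (trans (cong ∣_∣ (v≗e i)) (∣basis∣ c i)))

  affineProb-basis : ∀ {v} c → v ≗ basis c → affineProb A v ≡ bitℚ (Ea c)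
  affineProb-basis {v} c v≗e with norm₁ A v ℚ.≟ 0ℚ
  ... | yes ‖v‖≡0 = ⊥-elim (1ℚ≢0ℚ (trans (sym (norm₁-basis c v≗e)) ‖v‖≡0))
  ... | no ‖v‖≢0 =
    trans (÷-identityʳ _ _ {{≢-nonZero ‖v‖≢0}} (norm₁-basis c v≗e)) (accMass-basis c v≗e)

  acceptProb≡bitℚ⇒computesExactly : ∀ f → (∀ w → acceptProb A w ≡ bitℚ (f w)) → ComputesExactly A f
  acceptProb≡bitℚ⇒computesExactly f prob w =
    (λ fw≡1 → trans (prob w) (cong bitℚ fw≡1)) , (λ fw≡0 → trans (prob w) (cong bitℚ fw≡0))

infixl 5 _↾_

_↾_ : ∀ {n} → (Fin n → Bool) → ℕ → Fin n → Bool
(z ↾ t) i = does (toℕ i <? t) ∧ z i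

does-<?-suc : ∀ {a b} → a ≢ b → does (a <? suc b) ≡ does (a <? b)
does-<?-suc {a} {b} a≢b = by-cases (a <? b)
  where
  by-cases : Dec (a < b) → does (a <? suc b) ≡ does (a <? b)
  by-cases (yes a<b) = trans (dec-true (a <? suc b) (m<n⇒m<1+n a<b)) (sym (dec-true (a <? b) a<b))
  by-cases (no a≮b)  = trans (dec-false (a <? suc b) (λ a<1+b → a≮b (≤∧≢⇒< (s≤s⁻¹ a<1+b) a≢b)))
                             (sym (dec-false (a <? b) a≮b))

module _ {n} (z : Fin n → Bool) where

  ↾-≥ : ∀ {t} → n ≤ t → ∀ i → (z ↾ t) i ≡ z i
  ↾-≥ {t} n≤t i = cong (_∧ z i) (dec-true (toℕ i <? t) (<-≤-trans (toℕ<n i) n≤t))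

  ↾-self : ∀ i → (z ↾ toℕ i) i ≡ false
  ↾-self i = cong (_∧ z i) (dec-false (toℕ i <? toℕ i) (<-irrefl refl))

  ↾-suc-self : ∀ i → (z ↾ suc (toℕ i)) i ≡ z i
  ↾-suc-self i = cong (_∧ z i) (dec-true (toℕ i <? suc (toℕ i)) (n<1+n (toℕ i)))

  ↾-suc-other : ∀ {i j} → i ≢ j → (z ↾ suc (toℕ i)) j ≡ (z ↾ toℕ i) j
  ↾-suc-other {i} {j} i≢j = cong (_∧ z j) (does-<?-suc (λ j≡i → i≢j (toℕ-injective (sym j≡i))))

weight : ∀ {n} → Fin n → Bool → ℕ
weight i b = suc (toℕ i) ℕ.* bit b

module _ {n} (q : ℕ) (z : Fin n → Bool) where

  weightSum-↾-zero : weightSum n (suc q) (z ↾ 0) ≡ 0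
  weightSum-↾-zero = cong (_% suc q) (trans (Σℕ-cong {n} λ i → *-zeroʳ (suc (toℕ i))) (Σℕ-zero n))

  weightSum-↾-all : weightSum n (suc q) (z ↾ n) ≡ weightSum n (suc q) z
  weightSum-↾-all = cong (_% suc q) (Σℕ-cong λ i → cong (weight i) (↾-≥ z ≤-refl i))

  weightSum-↾-suc : ∀ i → weightSum n (suc q) (z ↾ suc (toℕ i))
                        ≡ (weightSum n (suc q) (z ↾ toℕ i) ℕ.+ weight i (z i)) % suc q
  weightSum-↾-suc i = begin
    Σℕ n after % suc q                         ≡⟨ cong (_% suc q) (Σℕ-insert before after i
                                                    (λ j i≢j → cong (weight j) (↾-suc-other z i≢j))
                                                    (trans (cong (weight i) (↾-self z i)) (*-zeroʳ (suc (toℕ i))))) ⟩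
    (Σℕ n before ℕ.+ after i) % suc q          ≡⟨ cong (λ b → (Σℕ n before ℕ.+ weight i b) % suc q) (↾-suc-self z i) ⟩
    (Σℕ n before ℕ.+ weight i (z i)) % suc q   ≡⟨ [m%n+o]%n≡[m+o]%n (Σℕ n before) (weight i (z i)) (suc q) ⟨
    (Σℕ n before % suc q ℕ.+ weight i (z i)) % suc q ∎
    where
    before after : Fin n → ℕ
    before j = weight j ((z ↾ toℕ i) j)
    after  j = weight j ((z ↾ suc (toℕ i)) j)

-- Mirrors the case analysis in MWS, so that MWS-sharedIndex holds clause by clause.
sharedIndex : ∀ n → ℕ → ℕ → Maybe (Fin n)
sharedIndex n a b with a ℕ.≟ b
... | no _ = nothing
... | yes _ with a
...   | zero = nothing
...   | suc k with k <? n
...     | yes k<n = just (fromℕ< k<n)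
...     | no _    = nothing

MWS-sharedIndex : ∀ n p x y →
  MWS n p x y ≡ maybe′ (λ i → x i xor y i) false (sharedIndex n (weightSum n p x) (weightSum n p y))
MWS-sharedIndex n p x y with weightSum n p x ℕ.≟ weightSum n p y
... | no _ = refl
... | yes _ with weightSum n p x
...   | zero = refl
...   | suc k with k <? n
...     | yes _ = refl
...     | no _  = refl

sharedIndex-just : ∀ n a b {i} → sharedIndex n a b ≡ just i → a ≡ suc (toℕ i)
sharedIndex-just n a b eq   with a ℕ.≟ b
sharedIndex-just n a b ()   | no _
sharedIndex-just n a b eq   | yes _ with a
sharedIndex-just n a b ()   | yes _ | zero
sharedIndex-just n a b eq   | yes _ | suc k with k <? n
sharedIndex-just n a b refl | yes _ | suc k | yes k<n = cong suc (sym (toℕ-fromℕ< k<n))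
sharedIndex-just n a b ()   | yes _ | suc k | no _

isZero : ∀ {m} → Fin m → Bool
isZero zero    = true
isZero (suc _) = false

module MWSAutomaton (n q : ℕ) where

  p : ℕ
  p = suc q

  registers : Fin (p ℕ.* p) → Fin p × Fin p
  registers = remQuot p

  registers-combine : ∀ a b → registers (combine a b) ≡ (a , b)
  registers-combine = remQuot-combine

  start : Fin (p ℕ.* p)
  start = combine {p} {p} zero zero

  _⊕_ : Fin p → ℕ → Fin p
  a ⊕ c = (toℕ a ℕ.+ c) mod p

  ⊕-weight : ∀ (z : Fin n → Bool) i {a} → toℕ a ≡ weightSum n p (z ↾ toℕ i) →
             toℕ (a ⊕ weight i (z i)) ≡ weightSum n p (z ↾ suc (toℕ i))
  ⊕-weight z i {a} a≡ = begin
    toℕ (a ⊕ weight i (z i))                             ≡⟨ toℕ-fromℕ< _ ⟩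
    (toℕ a ℕ.+ weight i (z i)) % p                       ≡⟨ cong (λ c → (c ℕ.+ weight i (z i)) % p) a≡ ⟩
    (weightSum n p (z ↾ toℕ i) ℕ.+ weight i (z i)) % p  ≡⟨ weightSum-↾-suc q z i ⟨
    weightSum n p (z ↾ suc (toℕ i))                      ∎

  δ⊎ : Fin n ⊎ Fin n → Fin (p ℕ.* p) → Bool → Fin (p ℕ.* p)
  δ⊎ (inj₁ i) s b = combine (proj₁ (registers s) ⊕ weight i b) (proj₂ (registers s))
  δ⊎ (inj₂ i) s b = combine (proj₁ (registers s)) (proj₂ (registers s) ⊕ weight i b)

  load : Fin n → Matrix (suc n)
  load i = 1ᴹ +ᴹ (basis (suc i) -ᵛ basis zero) ⊗ 𝟙

  -- Affine state zero is e₀, the only accepting one; suc i is the state of the 0-based variable i.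
  outcome : Fin n → Bool → Bool → Fin (suc n)
  outcome i c b = if c xor b then zero else suc i

  select : Bool → Fin n → Matrix (suc n)
  select b i = (basis (outcome i true b) -ᵛ basis (outcome i false b)) ⊗ basis (suc i)
            +ᴹ basis (outcome i false b) ⊗ 𝟙

  T⊎ : Fin n ⊎ Fin n → Fin (p ℕ.* p) → Bool → Matrix (suc n)
  T⊎ (inj₁ i) s b = if b then load i else 1ᴹ
  T⊎ (inj₂ i) s b = if does (toℕ (proj₁ (registers s)) ℕ.≟ suc (toℕ i)) then select b i else 1ᴹ

  load-colSum : ∀ i c → colSum (load i) c ≡ 1ℚ
  load-colSum i c = trans (colSum-+ᴹ 1ᴹ ((basis (suc i) -ᵛ basis zero) ⊗ 𝟙) c)
                          (cong₂ _+_ (colSum-1ᴹ c) (colSum-difference⊗ (suc i) zero 𝟙 c))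

  select-colSum : ∀ b i c → colSum (select b i) c ≡ 1ℚ
  select-colSum b i c =
    trans (colSum-+ᴹ ((basis (outcome i true b) -ᵛ basis (outcome i false b)) ⊗ basis (suc i))
                     (basis (outcome i false b) ⊗ 𝟙) c)
          (cong₂ _+_ (colSum-difference⊗ (outcome i true b) (outcome i false b) (basis (suc i)) c)
                     (colSum-basis⊗𝟙 (outcome i false b) c))

  T⊎-colSum : ∀ d s b c → colSum (T⊎ d s b) c ≡ 1ℚ
  T⊎-colSum (inj₁ i) s true  c = load-colSum i c
  T⊎-colSum (inj₁ i) s false c = colSum-1ᴹ c
  T⊎-colSum (inj₂ i) s b     c with does (toℕ (proj₁ (registers s)) ℕ.≟ suc (toℕ i))
  ... | true  = select-colSum b i c
  ... | false = colSum-1ᴹ c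

  automaton : AfOBDD (n ℕ.+ n) (p ℕ.* p) (suc n)
  automaton = record
    { sI     = start
    ; Sa     = λ s → is-just (sharedIndex n (toℕ (proj₁ (registers s))) (toℕ (proj₂ (registers s))))
    ; Ea     = isZero
    ; v₀     = basis zero
    ; v₀-sum = Σℚ-basis {suc n} zero
    ; π      = Permutation.id
    ; δ      = δ⊎ ∘ splitAt n
    ; T      = T⊎ ∘ splitAt n
    ; T-col  = λ j → T⊎-colSum (splitAt n j)
    }

  isZero-outcome : ∀ i c b → isZero (outcome i c b) ≡ c xor b
  isZero-outcome i c b with c xor b
  ... | true  = refl
  ... | false = refl

  load-app : ∀ i {v} → Σℚ (suc n) v ≡ 1ℚ → ∀ r → (load i · v) (suc r) ≡ v (suc r) + basis i r
  load-app i {v} mass r = begin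
    (load i · v) (suc r)                             ≡⟨ ·-+ᴹ 1ᴹ (D ⊗ 𝟙) v (suc r) ⟩
    (1ᴹ · v) (suc r) + ((D ⊗ 𝟙) · v) (suc r)        ≡⟨ cong₂ _+_ (·-1ᴹ v (suc r)) (·-⊗𝟙 D v (suc r)) ⟩
    v (suc r) + (basis i r - 0ℚ) * Σℚ (suc n) v      ≡⟨ cong (λ s → v (suc r) + (basis i r - 0ℚ) * s) mass ⟩
    v (suc r) + (basis i r - 0ℚ) * 1ℚ                ≡⟨ cong (v (suc r) +_)
                                                          (solve 1 (λ a → (a :- con 0ℚ) :* con 1ℚ := a) refl (basis i r)) ⟩
    v (suc r) + basis i r                            ∎
    where
    D : Fin (suc n) → ℚ
    D = basis (suc i) -ᵛ basis zero

  load-if-app : ∀ b i {v} → Σℚ (suc n) v ≡ 1ℚ →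
                ∀ r → ((if b then load i else 1ᴹ) · v) (suc r) ≡ v (suc r) + bitℚ b * basis i r
  load-if-app true  i {v} mass r =
    trans (load-app i {v} mass r) (cong (v (suc r) +_) (sym (ℚ.*-identityˡ (basis i r))))
  load-if-app false i {v} mass r =
    trans (·-1ᴹ v (suc r)) (sym (trans (cong (v (suc r) +_) (ℚ.*-zeroˡ (basis i r))) (ℚ.+-identityʳ _)))

  load-if-↾ : ∀ (z : Fin n → Bool) i {v} → Σℚ (suc n) v ≡ 1ℚ → (∀ r → v (suc r) ≡ bitℚ ((z ↾ toℕ i) r)) →
              ∀ r → ((if z i then load i else 1ᴹ) · v) (suc r) ≡ bitℚ ((z ↾ suc (toℕ i)) r)
  load-if-↾ z i {v} mass loaded r with i Fin.≟ r
  ... | yes refl = begin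
    ((if z i then load i else 1ᴹ) · v) (suc i)  ≡⟨ load-if-app (z i) i {v} mass i ⟩
    v (suc i) + bitℚ (z i) * basis i i          ≡⟨ cong₂ (λ a e → a + bitℚ (z i) * e)
                                                      (trans (loaded i) (cong bitℚ (↾-self z i))) (basis-diag i) ⟩
    0ℚ + bitℚ (z i) * 1ℚ                        ≡⟨ trans (ℚ.+-identityˡ _) (ℚ.*-identityʳ _) ⟩
    bitℚ (z i)                                  ≡⟨ cong bitℚ (↾-suc-self z i) ⟨
    bitℚ ((z ↾ suc (toℕ i)) i)                  ∎
  ... | no i≢r = begin
    ((if z i then load i else 1ᴹ) · v) (suc r)  ≡⟨ load-if-app (z i) i {v} mass r ⟩
    v (suc r) + bitℚ (z i) * basis i r          ≡⟨ cong (λ e → v (suc r) + bitℚ (z i) * e) (basis-off i≢r) ⟩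
    v (suc r) + bitℚ (z i) * 0ℚ                 ≡⟨ trans (cong (v (suc r) +_) (ℚ.*-zeroʳ (bitℚ (z i)))) (ℚ.+-identityʳ _) ⟩
    v (suc r)                                   ≡⟨ loaded r ⟩
    bitℚ ((z ↾ toℕ i) r)                        ≡⟨ cong bitℚ (↾-suc-other z i≢r) ⟨
    bitℚ ((z ↾ suc (toℕ i)) r)                  ∎

  select-app : ∀ b c i {v} → Σℚ (suc n) v ≡ 1ℚ → v (suc i) ≡ bitℚ c →
               (select b i · v) ≗ basis (outcome i c b)
  select-app b c i {v} mass vᵢ r = begin
    (select b i · v) r                                      ≡⟨ ·-+ᴹ (D ⊗ basis (suc i)) (basis F ⊗ 𝟙) v r ⟩
    ((D ⊗ basis (suc i)) · v) r + ((basis F ⊗ 𝟙) · v) r    ≡⟨ cong₂ _+_ (·-⊗basis D (suc i) v r) (·-⊗𝟙 (basis F) v r) ⟩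
    D r * v (suc i) + basis F r * Σℚ (suc n) v              ≡⟨ cong₂ (λ a s → D r * a + basis F r * s) vᵢ mass ⟩
    D r * bitℚ c + basis F r * 1ℚ                           ≡⟨ interpolate c (basis T r) (basis F r) ⟩
    (if c then basis T r else basis F r)                    ≡⟨ basis-outcome c ⟩
    basis (outcome i c b) r                                 ∎
    where
    T F : Fin (suc n)
    T = outcome i true b
    F = outcome i false b
    D : Fin (suc n) → ℚ
    D = basis T -ᵛ basis F
    basis-outcome : ∀ c → (if c then basis T r else basis F r) ≡ basis (outcome i c b) r
    basis-outcome true  = refl
    basis-outcome false = refl

  module Run (w : Fin (n ℕ.+ n) → Bool) where

    x y : Fin n → Bool
    x = xPart n w
    y = yPart n w

    State : Set
    State = Fin (p ℕ.* p) × (Fin (suc n) → ℚ)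

    advance : State → Fin (n ℕ.+ n) → State
    advance = step automaton w

    step-x : ∀ i (st : State) →
             advance st (i ↑ˡ n) ≡ (δ⊎ (inj₁ i) (proj₁ st) (x i) , T⊎ (inj₁ i) (proj₁ st) (x i) · proj₂ st)
    step-x i (s , v) = cong (λ d → δ⊎ d s (x i) , T⊎ d s (x i) · v) (splitAt-↑ˡ n i n)

    step-y : ∀ j (st : State) →
             advance st (n ↑ʳ j) ≡ (δ⊎ (inj₂ j) (proj₁ st) (y j) , T⊎ (inj₂ j) (proj₁ st) (y j) · proj₂ st)
    step-y j (s , v) = cong (λ d → δ⊎ d s (y j) , T⊎ d s (y j) · v) (splitAt-↑ʳ n n j)

    record XInv (t : ℕ) (st : State) : Set where
      field
        x-sum  : toℕ (proj₁ (registers (proj₁ st))) ≡ weightSum n p (x ↾ t)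
        y-zero : toℕ (proj₂ (registers (proj₁ st))) ≡ 0
        mass   : Σℚ (suc n) (proj₂ st) ≡ 1ℚ
        loaded : ∀ r → proj₂ st (suc r) ≡ bitℚ ((x ↾ t) r)

    record YInv (t : ℕ) (st : State) : Set where
      field
        x-sum   : toℕ (proj₁ (registers (proj₁ st))) ≡ weightSum n p x
        y-sum   : toℕ (proj₂ (registers (proj₁ st))) ≡ weightSum n p (y ↾ t)
        mass    : Σℚ (suc n) (proj₂ st) ≡ 1ℚ
        pending : ∀ i → weightSum n p x ≡ suc (toℕ i) → t ≤ toℕ i → proj₂ st (suc i) ≡ bitℚ (x i)
        decided : ∀ i → weightSum n p x ≡ suc (toℕ i) → toℕ i < t → proj₂ st ≗ basis (outcome i (x i) (y i))

    x-start : XInv 0 (start , basis zero)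
    x-start = record
      { x-sum  = trans (cong (toℕ ∘ proj₁) (registers-combine zero zero)) (sym (weightSum-↾-zero q x))
      ; y-zero = cong (toℕ ∘ proj₂) (registers-combine zero zero)
      ; mass   = Σℚ-basis {suc n} zero
      ; loaded = λ _ → refl
      }

    x-step : ∀ i {st} → XInv (toℕ i) st → XInv (suc (toℕ i)) (advance st (i ↑ˡ n))
    x-step i {s , v} I = subst (XInv (suc (toℕ i))) (sym (step-x i (s , v))) (record
      { x-sum  = trans (cong (toℕ ∘ proj₁) (registers-combine a′ b)) (⊕-weight x i x-sum)
      ; y-zero = trans (cong (toℕ ∘ proj₂) (registers-combine a′ b)) y-zero
      ; mass   = trans (Σℚ-· (T⊎ (inj₁ i) s (x i)) v (T⊎-colSum (inj₁ i) s (x i))) mass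
      ; loaded = load-if-↾ x i {v} mass loaded
      })
      where
      open XInv I
      a′ b : Fin p
      a′ = proj₁ (registers s) ⊕ weight i (x i)
      b  = proj₂ (registers s)

    x-to-y : ∀ {st} → XInv n st → YInv 0 st
    x-to-y I = record
      { x-sum   = trans x-sum (weightSum-↾-all q x)
      ; y-sum   = trans y-zero (sym (weightSum-↾-zero q y))
      ; mass    = mass
      ; pending = λ i _ _ → trans (loaded i) (cong bitℚ (↾-≥ x ≤-refl i))
      ; decided = λ i _ ()
      }
      where open XInv I

    y-step : ∀ j {st} → YInv (toℕ j) st → YInv (suc (toℕ j)) (advance st (n ↑ʳ j))
    y-step j {s , v} I = subst (YInv (suc (toℕ j))) (sym (step-y j (s , v))) (record
      { x-sum   = trans (cong (toℕ ∘ proj₁) (registers-combine a b′)) x-sum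
      ; y-sum   = trans (cong (toℕ ∘ proj₂) (registers-combine a b′)) (⊕-weight y j y-sum)
      ; mass    = trans (Σℚ-· M v (T⊎-colSum (inj₂ j) s (y j))) mass
      ; pending = pending′
      ; decided = decided′
      })
      where
      open YInv I
      a b′ : Fin p
      a  = proj₁ (registers s)
      b′ = proj₂ (registers s) ⊕ weight j (y j)
      M : Matrix (suc n)
      M = T⊎ (inj₂ j) s (y j)
      M-select : ∀ {i} → weightSum n p x ≡ suc (toℕ i) → i ≡ j → M ≡ select (y j) j
      M-select h refl = cong (λ d → if d then select (y j) j else 1ᴹ) (dec-true (_ ℕ.≟ _) (trans x-sum h))
      M-skip : ∀ {i} → weightSum n p x ≡ suc (toℕ i) → i ≢ j → M ≡ 1ᴹ
      M-skip h i≢j = cong (λ d → if d then select (y j) j else 1ᴹ) (dec-false (_ ℕ.≟ _)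
        λ a≡1+j → i≢j (toℕ-injective (cong ℕ.pred (trans (sym h) (trans (sym x-sum) a≡1+j)))))
      pending′ : ∀ i → weightSum n p x ≡ suc (toℕ i) → suc (toℕ j) ≤ toℕ i → (M · v) (suc i) ≡ bitℚ (x i)
      pending′ i h j<i = begin
        (M · v) (suc i)   ≡⟨ cong (λ N → (N · v) (suc i)) (M-skip h λ { refl → <-irrefl refl j<i }) ⟩
        (1ᴹ · v) (suc i)  ≡⟨ ·-1ᴹ v (suc i) ⟩
        v (suc i)         ≡⟨ pending i h (<⇒≤ j<i) ⟩
        bitℚ (x i)        ∎
      decided′ : ∀ i → weightSum n p x ≡ suc (toℕ i) → toℕ i < suc (toℕ j) →
                 (M · v) ≗ basis (outcome i (x i) (y i))
      decided′ i h i≤j r with i Fin.≟ j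
      ... | yes refl = trans (cong (λ N → (N · v) r) (M-select h refl))
                             (select-app (y i) (x i) i {v} mass (pending i h ≤-refl) r)
      ... | no  i≢j  = trans (cong (λ N → (N · v) r) (M-skip h i≢j))
                             (trans (·-1ᴹ v r) (decided i h (≤∧≢⇒< (s≤s⁻¹ i≤j) (i≢j ∘ toℕ-injective)) r))

    run-split : run automaton w ≡ foldl advance (foldl advance (start , basis zero) (tabulate (_↑ˡ n)))
                                                (tabulate (n ↑ʳ_))
    run-split = trans (cong (foldl advance _) (tabulate-+ n (λ j → j)))
                      (foldl-++ advance (start , basis zero) (tabulate (_↑ˡ n)) (tabulate (n ↑ʳ_)))

    run-invariant : YInv n (run automaton w)
    run-invariant = subst (YInv n) (sym run-split)
      (foldl-tabulate-invariant YInv y-step (x-to-y (foldl-tabulate-invariant XInv x-step x-start)))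

    acceptProb-MWS : acceptProb automaton w ≡ bitℚ (MWS n p x y)
    acceptProb-MWS = begin
      acceptProb automaton w                          ≡⟨ cong₂ (λ a b → if is-just (sharedIndex n a b) then Pv else 0ℚ)
                                                           x-sum (trans y-sum (weightSum-↾-all q y)) ⟩
      (if is-just shared then Pv else 0ℚ)             ≡⟨ by-cases shared (λ i eq →
                                                           decided i (sharedIndex-just n _ _ eq) (toℕ<n i)) ⟩
      bitℚ (maybe′ (λ i → x i xor y i) false shared)  ≡⟨ cong bitℚ (MWS-sharedIndex n p x y) ⟨
      bitℚ (MWS n p x y)                              ∎
      where
      open YInv run-invariant
      v : Fin (suc n) → ℚ
      v = proj₂ (run automaton w)
      Pv : ℚ
      Pv = affineProb automaton v
      shared : Maybe (Fin n)
      shared = sharedIndex n (weightSum n p x) (weightSum n p y)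
      by-cases : ∀ result → (∀ i → result ≡ just i → v ≗ basis (outcome i (x i) (y i))) →
                 (if is-just result then Pv else 0ℚ) ≡ bitℚ (maybe′ (λ i → x i xor y i) false result)
      by-cases nothing  _  = refl
      by-cases (just i) v≗ =
        trans (affineProb-basis automaton _ (v≗ i refl)) (cong bitℚ (isZero-outcome i (x i) (y i)))

theorem4 : (n : ℕ) → 1 ≤ n → (p : ℕ) → IsSmallestPrimeAbove n p →
    Σ[ A ∈ AfOBDD (n ℕ.+ n) (p ℕ.* p) (suc n) ]
    (IdentityOrder A × ComputesExactly A (λ w → MWS n p (xPart n w) (yPart n w)))
theorem4 n _ zero    (_ , () , _)
theorem4 n _ (suc q) _ =
  automaton , (λ _ → refl) , acceptProb≡bitℚ⇒computesExactly automaton _ Run.acceptProb-MWS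
  where open MWSAutomaton n q
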